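{- Let $n\ge 1$ and $I\subseteq[n]$. Let $\overline{L}_n(I)$ be the set of $\sigma\in S_n$ with $\overline{L}(\sigma)=I$, and $F_n(I)$ the set of $\sigma\in S_n$ with $F(\sigma)=I$. Then there is a bijection $\Phi:\overline{L}_n(I)\to F_n(I)$ such that for every $\sigma\in\overline{L}_n(I)$, $$\mathrm{jump}(\sigma)=\mathrm{exc}(\Phi(\sigma))\quad\text{and}\quad \mathrm{des}(\sigma)=\mathrm{drop}(\Phi(\sigma)).$$
   Context: $S_n$ is the set of permutations $\sigma=\sigma_1\cdots\sigma_n$ of $[n]$, with the convention $\sigma_0=0$. $\overline{L}(\sigma)=\{\sigma_i : 1\le i\le n,\ \sigma_{i-1}+1=\sigma_i\}$ (the set of values at left successions), and $F(\sigma)=\{i : 1\le i\le n,\ \sigma_i=i\}$ (the set of fixed points). $\mathrm{jump}(\sigma)$ is the number of indices $1\le i\le n$ with $\sigma_i\ge\sigma_{i-1}+2$; $\mathrm{des}(\sigma)$ is the number of indices $1\le i\le n-1$ with $\sigma_i>\sigma_{i+1}$; $\mathrm{exc}(\sigma)$ and $\mathrm{drop}(\sigma)$ are the numbers of indices $1\le i\le n$ with $\sigma_i>i$ and $\sigma_i<i$, respectively. -}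

module Defs where

open import Data.Nat using (ℕ; zero; suc; _+_; _<_; _≤_; _≡ᵇ_; _<ᵇ_)
open import Data.Fin using (Fin; toℕ; zero; suc; inject₁)
open import Data.Vec using (Vec; []; _∷_; lookup; tabulate)
open import Data.Bool using (Bool; true; false; _∧_)
open import Data.Bool.ListAction using (any)
open import Data.List using (List; filterᵇ; length) renaming (allFin to allFinL)
open import Data.Product using (Σ; _×_; _,_)
open import Function.Definitions using (Injective)
open import Relation.Binary.PropositionalEquality using (_≡_)
open import Data.Fin.Subset using (Subset)

-- A permutation σ = σ₁⋯σₙ of [n] is represented by the word
-- (σ₁,…,σₙ) : Vec (Fin n) n, where the value k ∈ [n] is the
-- element of Fin n with toℕ = k - 1, and position i ∈ [n] is index i-1.
-- It is a permutation iff the word is injective (hence bijective, being finite).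
Perm : ℕ → Set
Perm n = Σ (Vec (Fin n) n) (λ w → Injective _≡_ _≡_ (lookup w))

word : ∀ {n} → Perm n → Vec (Fin n) n
word (w , _) = w

val : ∀ {n} → Perm n → Fin n → ℕ
val σ i = suc (toℕ (lookup (word σ) i))

prevVal : ∀ {n} → Perm n → Fin n → ℕ
prevVal σ zero = 0
prevVal {suc n} σ (suc i) = val σ (inject₁ i)

count : ∀ {n} → (Fin n → Bool) → ℕ
count {n} p = length (filterᵇ p (allFinL n))

-- As a Subset n (the value k is coordinate k-1): the characteristic vector
-- has `true` at coordinate v iff some i has σ_i = v+1 and σ_{i-1} + 1 = σ_i.
Lbar : ∀ {n} → Perm n → Subset n
Lbar {n} σ = tabulate (λ v → any (λ i → (val σ i ≡ᵇ suc (toℕ v)) ∧ (suc (prevVal σ i) ≡ᵇ val σ i)) (allFinL n))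

Fix : ∀ {n} → Perm n → Subset n
Fix σ = tabulate (λ i → val σ i ≡ᵇ suc (toℕ i))

jump : ∀ {n} → Perm n → ℕ
jump σ = count (λ i → suc (prevVal σ i) <ᵇ val σ i)

des : ∀ {n} → Perm n → ℕ
des {zero} σ = 0
des {suc n} σ = count {n} (λ i → val σ (suc i) <ᵇ val σ (inject₁ i))

exc : ∀ {n} → Perm n → ℕ
exc σ = count (λ i → suc (toℕ i) <ᵇ val σ i)

drop : ∀ {n} → Perm n → ℕ
drop σ = count (λ i → val σ i <ᵇ suc (toℕ i))

-- Read σ by values: the letter v is preceded by some σᵢ₋₁ (with σ₀ = 0) and is a jump,
-- a left succession or the end of a descent according as σᵢ₋₁ is below, equal to or
-- above v - 1.  Read τ by values too: v sits at τ⁻¹(v), an excedance, a fixed point or a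
-- drop according as τ⁻¹(v) is below, equal to or above v.  Φ is built by induction on n
-- so that both readings agree letter by letter; counting over values then turns jumps
-- into excedances, descents into drops and left successions into fixed points.
-- Removing the largest letter n from σ leaves σ' with n in some gap k; Φ(σ) is Φ(σ')
-- with a letter b moved to the end and n put in its place.  The gap determines b: the
-- gap right after n - 1 gives b = n, the last gap gives the letter after n - 1, and any
-- other gap the letter following it.  This is a bijection between gaps and choices of b,
-- so Φ is invertible, and it is exactly what keeps the two readings aligned.
module Submission where

open import Defs
open import Data.Nat using (ℕ; zero; suc; _<_; _≤_; _≥_; _<ᵇ_; _≡ᵇ_; z≤n; s≤s)
open import Data.Nat.Properties using (+-0-commutativeMonoid; 1+n≰n; 1+n≢n; suc-injective; ≤∧≢⇒<; m<n⇒m<1+n)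
  renaming (_≟_ to _≟ℕ_)
open import Data.Bool using (Bool; true; false; _∧_)
open import Data.Bool.Properties using (∨-identityʳ)
open import Data.Bool.ListAction using (any)
open import Data.Fin using (Fin; zero; suc; toℕ; inject₁; fromℕ; punchIn; punchOut; pinch; lower₁)
open import Data.Fin.Properties using (_≟_; any?; injective⇒≤; punchOut-injective; punchIn-injective;
  punchInᵢ≢i; punchOut-punchIn; punchIn-punchOut; inject₁-injective; fromℕ≢inject₁;
  toℕ-injective; toℕ-fromℕ; toℕ-inject₁; toℕ<n; inject₁-lower₁)
  renaming (suc-injective to Fin-suc-injective)
open import Data.Fin.Permutation using (Permutation; permutation; _⟨$⟩ʳ_)
open import Data.Fin.Subset using (Subset)
open import Data.List using (filterᵇ; length) renaming (tabulate to tabulateL; allFin to allFinL)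
open import Data.Vec using (Vec; []; _∷_; lookup; map; tabulate; insertAt; removeAt)
open import Data.Vec.Properties using (lookup-map; map-∘; map-cong; map-id; tabulate∘lookup; tabulate-cong;
  insertAt-lookup; insertAt-punchIn; removeAt-insertAt; insertAt-removeAt; removeAt-punchOut)
open import Data.Product using (Σ; ∃; _×_; _,_; proj₁; proj₂)
open import Data.Sum using (_⊎_; inj₁; inj₂)
open import Function using (_∘_; id)
open import Function.Definitions using (Injective)
open import Relation.Nullary using (Dec; yes; no; contradiction)
open import Relation.Binary.PropositionalEquality
open import Data.Fin.Permutation.Components using (transpose; transpose-inverse)
open import Relation.Nullary.Decidable using (dec-true; dec-false; does-⇔)
open import Function.Bundles using (mk⇔)
import Algebra.Properties.CommutativeMonoid.Sum as CommutativeMonoidSum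

private
  variable
    m n : ℕ

bit : Bool → ℕ
bit true = 1
bit false = 0

open CommutativeMonoidSum +-0-commutativeMonoid using (sum; sum-permute; sum-cong-≗)

count-tabulate : ∀ {A : Set} (p : A → Bool) (f : Fin n → A) →
  length (filterᵇ p (tabulateL f)) ≡ sum (bit ∘ p ∘ f)
count-tabulate {zero} p f = refl
count-tabulate {suc n} p f with p (f zero)
... | true  = cong suc (count-tabulate p (f ∘ suc))
... | false = count-tabulate p (f ∘ suc)

count-cong : {p q : Fin n → Bool} → (∀ i → p i ≡ q i) → count p ≡ count q
count-cong {p = p} {q} p≗q = begin
  count p              ≡⟨ count-tabulate p id ⟩
  sum (bit ∘ p)        ≡⟨ sum-cong-≗ (cong bit ∘ p≗q) ⟩
  sum (bit ∘ q)        ≡⟨ count-tabulate q id ⟨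
  count q              ∎
  where open ≡-Reasoning

count-permute : (p : Fin n → Bool) (π : Permutation n n) → count p ≡ count (p ∘ (π ⟨$⟩ʳ_))
count-permute p π = begin
  count p                    ≡⟨ count-tabulate p id ⟩
  sum (bit ∘ p)              ≡⟨ sum-permute (bit ∘ p) π ⟩
  sum (bit ∘ p ∘ (π ⟨$⟩ʳ_))  ≡⟨ count-tabulate (p ∘ (π ⟨$⟩ʳ_)) id ⟨
  count (p ∘ (π ⟨$⟩ʳ_))      ∎
  where open ≡-Reasoning

Word : ℕ → Set
Word n = Vec (Fin n) n

IsPerm : Word n → Set
IsPerm w = Injective _≡_ _≡_ (lookup w)

-- The fallback value v is only reached when w is not a permutation.
position : Word n → Fin n → Fin n
position w v with any? (λ i → lookup w i ≟ v)
... | yes (i , _) = i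
... | no _ = v

lookup-position : (w : Word n) → IsPerm w → ∀ v → lookup w (position w v) ≡ v
lookup-position w w-inj v with any? (λ i → lookup w i ≟ v)
... | yes (_ , wᵢ≡v) = wᵢ≡v
lookup-position {suc n} w w-inj v | no ∄i = contradiction (injective⇒≤ avoid-inj) 1+n≰n
  where
  avoid : Fin (suc n) → Fin n
  avoid i = punchOut {i = v} {j = lookup w i} (λ v≡wᵢ → ∄i (i , sym v≡wᵢ))
  avoid-inj : Injective _≡_ _≡_ avoid
  avoid-inj {i} {j} eq = w-inj (punchOut-injective {i = v} _ _ eq)

position-lookup : (w : Word n) → IsPerm w → ∀ i → position w (lookup w i) ≡ i
position-lookup w w-inj i = w-inj (lookup-position w w-inj (lookup w i))

lookup⇒position : (w : Word n) → IsPerm w → ∀ {i v} → lookup w i ≡ v → position w v ≡ i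
lookup⇒position w w-inj refl = position-lookup w w-inj _

positionPermutation : (w : Word n) → IsPerm w → Permutation n n
positionPermutation w w-inj =
  permutation (position w) (lookup w) (position-lookup w w-inj) (lookup-position w w-inj)

count-byValue : (w : Word n) → IsPerm w → (p : Fin n → Bool) → count p ≡ count (p ∘ position w)
count-byValue w w-inj p = count-permute p (positionPermutation w w-inj)

-- Inserting and removing the largest letter

lookup-extensional : ∀ {A : Set} (xs ys : Vec A n) → (∀ i → lookup xs i ≡ lookup ys i) → xs ≡ ys
lookup-extensional xs ys eq = trans (sym (tabulate∘lookup xs)) (trans (tabulate-cong eq) (tabulate∘lookup ys))

punchIn-view : (k p : Fin (suc n)) → p ≡ k ⊎ ∃ λ j → p ≡ punchIn k j
punchIn-view k p with k ≟ p
... | yes k≡p = inj₁ (sym k≡p)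
... | no k≢p = inj₂ (punchOut k≢p , sym (punchIn-punchOut k≢p))

pinch-inject₁ : (i : Fin (suc n)) → pinch (fromℕ n) (inject₁ i) ≡ i
pinch-inject₁ zero = refl
pinch-inject₁ {suc n} (suc i) = cong suc (pinch-inject₁ i)

inject₁-pinch : (x : Fin (suc (suc n))) → x ≢ fromℕ (suc n) → inject₁ (pinch (fromℕ n) x) ≡ x
inject₁-pinch zero x≢max = refl
inject₁-pinch {zero} (suc zero) x≢max = contradiction refl x≢max
inject₁-pinch {suc n} (suc x) x≢max = cong suc (inject₁-pinch x (x≢max ∘ cong suc))

lowerAll : Vec (Fin (suc n)) n → Word n
lowerAll {zero} [] = []
lowerAll {suc n} xs = map (pinch (fromℕ n)) xs

lowerAll-map-inject₁ : (w : Word n) → lowerAll (map inject₁ w) ≡ w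
lowerAll-map-inject₁ {zero} [] = refl
lowerAll-map-inject₁ {suc n} w = begin
  map (pinch (fromℕ n)) (map inject₁ w) ≡⟨ map-∘ _ inject₁ w ⟨
  map (pinch (fromℕ n) ∘ inject₁) w     ≡⟨ map-cong pinch-inject₁ w ⟩
  map id w                              ≡⟨ map-id w ⟩
  w                                     ∎
  where open ≡-Reasoning

map-inject₁-lowerAll : (xs : Vec (Fin (suc n)) n) → (∀ i → lookup xs i ≢ fromℕ n) →
  map inject₁ (lowerAll xs) ≡ xs
map-inject₁-lowerAll {zero} [] _ = refl
map-inject₁-lowerAll {suc n} xs xs≢max = lookup-extensional _ _ λ i → begin
  lookup (map inject₁ (map (pinch (fromℕ n)) xs)) i ≡⟨ lookup-map i inject₁ (map _ xs) ⟩
  inject₁ (lookup (map (pinch (fromℕ n)) xs) i)     ≡⟨ cong inject₁ (lookup-map i _ xs) ⟩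
  inject₁ (pinch (fromℕ n) (lookup xs i))           ≡⟨ inject₁-pinch _ (xs≢max i) ⟩
  lookup xs i                                       ∎
  where open ≡-Reasoning

lookup-lowerAll : (xs : Vec (Fin (suc n)) n) (i : Fin n) → lookup xs i ≢ fromℕ n →
  inject₁ (lookup (lowerAll xs) i) ≡ lookup xs i
lookup-lowerAll {suc n} xs i xsᵢ≢max =
  trans (cong inject₁ (lookup-map i _ xs)) (inject₁-pinch _ xsᵢ≢max)

lookup-removeAt : ∀ {A : Set} (xs : Vec A (suc n)) k j → lookup (removeAt xs k) j ≡ lookup xs (punchIn k j)
lookup-removeAt xs k j = trans (cong (lookup (removeAt xs k)) (sym (punchOut-punchIn k)))
                               (removeAt-punchOut xs (punchInᵢ≢i k j ∘ sym))

insertMax : Word n → Fin (suc n) → Word (suc n)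
insertMax {n} w k = insertAt (map inject₁ w) k (fromℕ n)

removeMax : Word (suc n) → Fin (suc n) → Word n
removeMax w k = lowerAll (removeAt w k)

lookup-insertMax-self : (w : Word n) (k : Fin (suc n)) → lookup (insertMax w k) k ≡ fromℕ n
lookup-insertMax-self w k = insertAt-lookup _ k _

lookup-insertMax-punchIn : (w : Word n) (k : Fin (suc n)) (j : Fin n) → lookup (insertMax w k) (punchIn k j) ≡ inject₁ (lookup w j)
lookup-insertMax-punchIn w k j = trans (insertAt-punchIn _ k _ j) (lookup-map j inject₁ w)

lookup-removeMax : (w : Word (suc n)) (k : Fin (suc n)) (j : Fin n) → lookup w (punchIn k j) ≢ fromℕ n →
  inject₁ (lookup (removeMax w k) j) ≡ lookup w (punchIn k j)
lookup-removeMax w k j w≢max = trans (lookup-lowerAll _ j (w≢max ∘ trans (sym (lookup-removeAt w k j))))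
                                     (lookup-removeAt w k j)

removeMax-insertMax : (w : Word n) (k : Fin (suc n)) → removeMax (insertMax w k) k ≡ w
removeMax-insertMax w k = trans (cong lowerAll (removeAt-insertAt _ k _)) (lowerAll-map-inject₁ w)

insertMax-removeMax : (w : Word (suc n)) (k : Fin (suc n)) → IsPerm w → lookup w k ≡ fromℕ n →
  insertMax (removeMax w k) k ≡ w
insertMax-removeMax {n} w k w-inj wₖ≡max = begin
  insertAt (map inject₁ (lowerAll (removeAt w k))) k (fromℕ n)
    ≡⟨ cong (λ xs → insertAt xs k (fromℕ n)) (map-inject₁-lowerAll _ others≢max) ⟩
  insertAt (removeAt w k) k (fromℕ n)
    ≡⟨ cong (insertAt (removeAt w k) k) wₖ≡max ⟨
  insertAt (removeAt w k) k (lookup w k)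
    ≡⟨ insertAt-removeAt w k ⟩
  w ∎
  where
  open ≡-Reasoning
  others≢max : ∀ j → lookup (removeAt w k) j ≢ fromℕ n
  others≢max j eq = punchInᵢ≢i k j (w-inj (trans (trans (sym (lookup-removeAt w k j)) eq) (sym wₖ≡max)))

lookup-insertMax-punchIn≢self : (w : Word n) (k : Fin (suc n)) (j : Fin n) →
  lookup (insertMax w k) (punchIn k j) ≢ lookup (insertMax w k) k
lookup-insertMax-punchIn≢self w k j eq = fromℕ≢inject₁ (begin
  fromℕ _                              ≡⟨ lookup-insertMax-self w k ⟨
  lookup (insertMax w k) k             ≡⟨ eq ⟨
  lookup (insertMax w k) (punchIn k j) ≡⟨ lookup-insertMax-punchIn w k j ⟩
  inject₁ (lookup w j)                 ∎)
  where open ≡-Reasoning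

insertMax-isPerm : (w : Word n) (k : Fin (suc n)) → IsPerm w → IsPerm (insertMax w k)
insertMax-isPerm w k w-inj {p} {q} eq with punchIn-view k p | punchIn-view k q
... | inj₁ p≡k | inj₁ q≡k = trans p≡k (sym q≡k)
... | inj₁ refl | inj₂ (j , refl) = contradiction (sym eq) (lookup-insertMax-punchIn≢self w k j)
... | inj₂ (j , refl) | inj₁ refl = contradiction eq (lookup-insertMax-punchIn≢self w k j)
... | inj₂ (i , refl) | inj₂ (j , refl) = cong (punchIn k) (w-inj (inject₁-injective
  (trans (sym (lookup-insertMax-punchIn w k i)) (trans eq (lookup-insertMax-punchIn w k j)))))

removeMax-isPerm : (w : Word (suc n)) (k : Fin (suc n)) → IsPerm w → lookup w k ≡ fromℕ n → IsPerm (removeMax w k)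
removeMax-isPerm {n} w k w-inj wₖ≡max {i} {j} eq = punchIn-injective k i j (w-inj (begin
  lookup w (punchIn k i)              ≡⟨ lookup-removeMax w k i (others≢max i) ⟨
  inject₁ (lookup (removeMax w k) i)  ≡⟨ cong inject₁ eq ⟩
  inject₁ (lookup (removeMax w k) j)  ≡⟨ lookup-removeMax w k j (others≢max j) ⟩
  lookup w (punchIn k j)              ∎))
  where
  open ≡-Reasoning
  others≢max : ∀ j → lookup w (punchIn k j) ≢ fromℕ n
  others≢max j eq = punchInᵢ≢i k j (w-inj (trans eq (sym wₖ≡max)))

maxPosition : Word (suc n) → Fin (suc n)
maxPosition {n} w = position w (fromℕ n)

removeTop : Word (suc n) → Word n
removeTop w = removeMax w (maxPosition w)

removeTop-isPerm : (w : Word (suc n)) → IsPerm w → IsPerm (removeTop w)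
removeTop-isPerm {n} w w-inj = removeMax-isPerm w _ w-inj (lookup-position w w-inj (fromℕ n))

insertMax-removeTop : (w : Word (suc n)) → IsPerm w → insertMax (removeTop w) (maxPosition w) ≡ w
insertMax-removeTop {n} w w-inj = insertMax-removeMax w _ w-inj (lookup-position w w-inj (fromℕ n))

maxPosition-insertMax : (w : Word n) (k : Fin (suc n)) → IsPerm w → maxPosition (insertMax w k) ≡ k
maxPosition-insertMax w k w-inj = lookup⇒position (insertMax w k) (insertMax-isPerm w k w-inj) (lookup-insertMax-self w k)

position-insertMax-inject₁ : (w : Word n) (k : Fin (suc n)) → IsPerm w → ∀ v →
  position (insertMax w k) (inject₁ v) ≡ punchIn k (position w v)
position-insertMax-inject₁ w k w-inj v = lookup⇒position (insertMax w k) (insertMax-isPerm w k w-inj)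
  (trans (lookup-insertMax-punchIn w k _) (cong inject₁ (lookup-position w w-inj v)))

transpose-left : (i j : Fin n) → transpose i j i ≡ j
transpose-left i j rewrite dec-true (i ≟ i) refl = refl

transpose-right : (i j : Fin n) → transpose i j j ≡ i
transpose-right i j with j ≟ i
... | yes j≡i = j≡i
... | no _ rewrite dec-true (j ≟ j) refl = refl

transpose-other : (i j k : Fin n) → k ≢ i → k ≢ j → transpose i j k ≡ k
transpose-other i j k k≢i k≢j rewrite dec-false (k ≟ i) k≢i | dec-false (k ≟ j) k≢j = refl

map-transpose-inverse : (i j : Fin n) (xs : Vec (Fin n) m) → map (transpose i j) (map (transpose j i) xs) ≡ xs
map-transpose-inverse i j xs = begin
  map (transpose i j) (map (transpose j i) xs) ≡⟨ map-∘ _ _ xs ⟨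
  map (transpose i j ∘ transpose j i) xs       ≡⟨ map-cong (λ _ → transpose-inverse i j) xs ⟩
  map id xs                                    ≡⟨ map-id xs ⟩
  xs                                           ∎
  where open ≡-Reasoning

map-transpose-isPerm : (i j : Fin n) (w : Word n) → IsPerm w → IsPerm (map (transpose i j) w)
map-transpose-isPerm i j w w-inj {p} {q} eq = w-inj (begin
  lookup w p                                      ≡⟨ transpose-inverse j i ⟨
  transpose j i (transpose i j (lookup w p))      ≡⟨ cong (transpose j i) (lookup-map p _ w) ⟨
  transpose j i (lookup (map (transpose i j) w) p) ≡⟨ cong (transpose j i) eq ⟩
  transpose j i (lookup (map (transpose i j) w) q) ≡⟨ cong (transpose j i) (lookup-map q _ w) ⟩
  transpose j i (transpose i j (lookup w q))      ≡⟨ transpose-inverse j i ⟩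
  lookup w q                                      ∎)
  where open ≡-Reasoning

punchIn-fromℕ : (j : Fin n) → punchIn (fromℕ n) j ≡ inject₁ j
punchIn-fromℕ zero = refl
punchIn-fromℕ (suc j) = cong suc (punchIn-fromℕ j)

appendMax : Word n → Word (suc n)
appendMax {n} w = insertMax w (fromℕ n)

appendMax-isPerm : (w : Word n) → IsPerm w → IsPerm (appendMax w)
appendMax-isPerm {n} w = insertMax-isPerm w (fromℕ n)

lookup-appendMax-inject₁ : (w : Word n) (j : Fin n) → lookup (appendMax w) (inject₁ j) ≡ inject₁ (lookup w j)
lookup-appendMax-inject₁ {n} w j =
  trans (cong (lookup (appendMax w)) (sym (punchIn-fromℕ j))) (lookup-insertMax-punchIn w (fromℕ n) j)

-- b moves to the new last position and the new largest letter takes its place.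
extend : Word n → Fin (suc n) → Word (suc n)
extend {n} w b = map (transpose b (fromℕ n)) (appendMax w)

retract : Word (suc n) → Word n
retract {n} τ = removeMax (map (transpose (fromℕ n) (lookup τ (fromℕ n))) τ) (fromℕ n)

lookup-extend-last : (w : Word n) (b : Fin (suc n)) → lookup (extend w b) (fromℕ n) ≡ b
lookup-extend-last {n} w b = begin
  lookup (extend w b) (fromℕ n)                      ≡⟨ lookup-map (fromℕ n) _ (appendMax w) ⟩
  transpose b (fromℕ n) (lookup (appendMax w) (fromℕ n)) ≡⟨ cong (transpose b (fromℕ n)) (lookup-insertMax-self w (fromℕ n)) ⟩
  transpose b (fromℕ n) (fromℕ n)                   ≡⟨ transpose-right b (fromℕ n) ⟩
  b                                                  ∎
  where open ≡-Reasoning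

lookup-extend-inject₁ : (w : Word n) (b : Fin (suc n)) (j : Fin n) →
  lookup (extend w b) (inject₁ j) ≡ transpose b (fromℕ n) (inject₁ (lookup w j))
lookup-extend-inject₁ w b j =
  trans (lookup-map (inject₁ j) _ (appendMax w)) (cong (transpose b _) (lookup-appendMax-inject₁ w j))

retract-extend : (w : Word n) (b : Fin (suc n)) → retract (extend w b) ≡ w
retract-extend {n} w b = begin
  removeMax (map (transpose (fromℕ n) (lookup (extend w b) (fromℕ n))) (extend w b)) (fromℕ n)
    ≡⟨ cong (λ c → removeMax (map (transpose (fromℕ n) c) (extend w b)) (fromℕ n)) (lookup-extend-last w b) ⟩
  removeMax (map (transpose (fromℕ n) b) (extend w b)) (fromℕ n)
    ≡⟨ cong (λ xs → removeMax xs (fromℕ n)) (map-transpose-inverse (fromℕ n) b (appendMax w)) ⟩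
  removeMax (appendMax w) (fromℕ n)
    ≡⟨ removeMax-insertMax w (fromℕ n) ⟩
  w ∎
  where open ≡-Reasoning

lookup-map-transpose-last : (τ : Word (suc n)) →
  lookup (map (transpose (fromℕ n) (lookup τ (fromℕ n))) τ) (fromℕ n) ≡ fromℕ n
lookup-map-transpose-last {n} τ = trans (lookup-map (fromℕ n) _ τ) (transpose-right (fromℕ n) (lookup τ (fromℕ n)))

extend-retract : (τ : Word (suc n)) → IsPerm τ → extend (retract τ) (lookup τ (fromℕ n)) ≡ τ
extend-retract {n} τ τ-inj = begin
  map (transpose b (fromℕ n)) (insertMax (removeMax u (fromℕ n)) (fromℕ n))
    ≡⟨ cong (map (transpose b (fromℕ n))) (insertMax-removeMax u (fromℕ n) u-inj (lookup-map-transpose-last τ)) ⟩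
  map (transpose b (fromℕ n)) u
    ≡⟨ map-transpose-inverse b (fromℕ n) τ ⟩
  τ ∎
  where
  open ≡-Reasoning
  b = lookup τ (fromℕ n)
  u = map (transpose (fromℕ n) b) τ
  u-inj = map-transpose-isPerm (fromℕ n) b τ τ-inj

extend-isPerm : (w : Word n) (b : Fin (suc n)) → IsPerm w → IsPerm (extend w b)
extend-isPerm {n} w b w-inj =
  map-transpose-isPerm b (fromℕ n) (appendMax w) (appendMax-isPerm w w-inj)

retract-isPerm : (τ : Word (suc n)) → IsPerm τ → IsPerm (retract τ)
retract-isPerm {n} τ τ-inj = removeMax-isPerm (map (transpose (fromℕ n) b) τ) (fromℕ n)
  (map-transpose-isPerm (fromℕ n) b τ τ-inj) (lookup-map-transpose-last τ)
  where b = lookup τ (fromℕ n)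

position-extend-last : (w : Word n) (b : Fin (suc n)) → IsPerm w → position (extend w b) b ≡ fromℕ n
position-extend-last w b w-inj = lookup⇒position (extend w b) (extend-isPerm w b w-inj) (lookup-extend-last w b)

position-extend-max : (w : Word n) (c : Fin n) → IsPerm w →
  position (extend w (inject₁ c)) (fromℕ n) ≡ inject₁ (position w c)
position-extend-max {n} w c w-inj = lookup⇒position (extend w b) (extend-isPerm w b w-inj) (begin
  lookup (extend w b) (inject₁ (position w c))
    ≡⟨ lookup-extend-inject₁ w b (position w c) ⟩
  transpose b (fromℕ n) (inject₁ (lookup w (position w c)))
    ≡⟨ cong (transpose b (fromℕ n) ∘ inject₁) (lookup-position w w-inj c) ⟩
  transpose b (fromℕ n) b
    ≡⟨ transpose-left b (fromℕ n) ⟩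
  fromℕ n ∎)
  where
  open ≡-Reasoning
  b = inject₁ c

position-extend-inject₁ : (w : Word n) (b : Fin (suc n)) → IsPerm w → ∀ c → inject₁ c ≢ b →
  position (extend w b) (inject₁ c) ≡ inject₁ (position w c)
position-extend-inject₁ {n} w b w-inj c c≢b = lookup⇒position (extend w b) (extend-isPerm w b w-inj) (begin
  lookup (extend w b) (inject₁ (position w c))
    ≡⟨ lookup-extend-inject₁ w b (position w c) ⟩
  transpose b (fromℕ n) (inject₁ (lookup w (position w c)))
    ≡⟨ cong (transpose b (fromℕ n) ∘ inject₁) (lookup-position w w-inj c) ⟩
  transpose b (fromℕ n) (inject₁ c)
    ≡⟨ transpose-other b (fromℕ n) (inject₁ c) c≢b (fromℕ≢inject₁ ∘ sym) ⟩
  inject₁ c ∎)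
  where open ≡-Reasoning

-- Gaps and the letters preceding them

fromℕ-or-inject₁ : (k : Fin (suc n)) → k ≡ fromℕ n ⊎ ∃ λ j → k ≡ inject₁ j
fromℕ-or-inject₁ {n} k with n ≟ℕ toℕ k
... | yes n≡k = inj₁ (toℕ-injective (trans (sym n≡k) (sym (toℕ-fromℕ n))))
... | no n≢k = inj₂ (lower₁ k n≢k , sym (inject₁-lower₁ k n≢k))

-- Gap k of a word lies just before its position k; before w k is the value (in 1, 2, …)
-- of the letter in front of the gap, and 0 for the first gap.
beforeFrom : ∀ {l} → ℕ → Vec (Fin m) l → Fin (suc l) → ℕ
beforeFrom a xs zero = a
beforeFrom a (x ∷ xs) (suc k) = beforeFrom (suc (toℕ x)) xs k

before : ∀ {l} → Vec (Fin m) l → Fin (suc l) → ℕ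
before = beforeFrom 0

beforeFrom-suc : ∀ {l} a (xs : Vec (Fin m) l) (p : Fin l) → beforeFrom a xs (suc p) ≡ suc (toℕ (lookup xs p))
beforeFrom-suc a (x ∷ xs) zero = refl
beforeFrom-suc a (x ∷ xs) (suc p) = beforeFrom-suc (suc (toℕ x)) xs p

before-suc : ∀ {l} (xs : Vec (Fin m) l) (p : Fin l) → before xs (suc p) ≡ suc (toℕ (lookup xs p))
before-suc = beforeFrom-suc 0

beforeFrom-map-inject₁ : ∀ {l} a (xs : Vec (Fin m) l) k → beforeFrom a (map inject₁ xs) k ≡ beforeFrom a xs k
beforeFrom-map-inject₁ a xs zero = refl
beforeFrom-map-inject₁ a (x ∷ xs) (suc k) rewrite toℕ-inject₁ x = beforeFrom-map-inject₁ (suc (toℕ x)) xs k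

beforeFrom-insertAt-self : ∀ {l} a (xs : Vec (Fin m) l) k v → beforeFrom a (insertAt xs k v) (inject₁ k) ≡ beforeFrom a xs k
beforeFrom-insertAt-self a xs zero v = refl
beforeFrom-insertAt-self a (x ∷ xs) (suc k) v = beforeFrom-insertAt-self (suc (toℕ x)) xs k v

beforeFrom-insertAt-after : ∀ {l} a (xs : Vec (Fin m) l) k v j → inject₁ j ≡ k →
  beforeFrom a (insertAt xs k v) (inject₁ (punchIn k j)) ≡ suc (toℕ v)
beforeFrom-insertAt-after a xs zero v zero refl = refl
beforeFrom-insertAt-after a (x ∷ xs) (suc k) v (suc j) refl = beforeFrom-insertAt-after (suc (toℕ x)) xs k v j refl

beforeFrom-insertAt-other : ∀ {l} a (xs : Vec (Fin m) l) k v j → inject₁ j ≢ k →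
  beforeFrom a (insertAt xs k v) (inject₁ (punchIn k j)) ≡ beforeFrom a xs (inject₁ j)
beforeFrom-insertAt-other a (x ∷ xs) zero v zero j≢k = contradiction refl j≢k
beforeFrom-insertAt-other a (x ∷ xs) zero v (suc j) j≢k = refl
beforeFrom-insertAt-other a (x ∷ xs) (suc k) v zero j≢k = refl
beforeFrom-insertAt-other a (x ∷ xs) (suc k) v (suc j) j≢k =
  beforeFrom-insertAt-other (suc (toℕ x)) xs k v j (j≢k ∘ cong suc)

before-insertMax-self : (w : Word n) (k : Fin (suc n)) → before (insertMax w k) (inject₁ k) ≡ before w k
before-insertMax-self w k = trans (beforeFrom-insertAt-self 0 (map inject₁ w) k _) (beforeFrom-map-inject₁ 0 w k)

before-insertMax-after : (w : Word n) (k : Fin (suc n)) (j : Fin n) → inject₁ j ≡ k →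
  before (insertMax w k) (inject₁ (punchIn k j)) ≡ suc n
before-insertMax-after {n} w k j j≡k =
  trans (beforeFrom-insertAt-after 0 (map inject₁ w) k (fromℕ n) j j≡k) (cong suc (toℕ-fromℕ n))

before-insertMax-other : (w : Word n) (k : Fin (suc n)) (j : Fin n) → inject₁ j ≢ k →
  before (insertMax w k) (inject₁ (punchIn k j)) ≡ before w (inject₁ j)
before-insertMax-other w k j j≢k =
  trans (beforeFrom-insertAt-other 0 (map inject₁ w) k _ j j≢k) (beforeFrom-map-inject₁ 0 w (inject₁ j))

predecessor : Word n → Fin n → ℕ
predecessor w v = before w (inject₁ (position w v))

predecessor-insertMax-max : (w : Word n) (k : Fin (suc n)) → IsPerm w →
  predecessor (insertMax w k) (fromℕ n) ≡ before w k
predecessor-insertMax-max w k w-inj =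
  trans (cong (before (insertMax w k) ∘ inject₁) (maxPosition-insertMax w k w-inj)) (before-insertMax-self w k)

predecessor-insertMax-after : (w : Word n) (k : Fin (suc n)) → IsPerm w → ∀ v →
  inject₁ (position w v) ≡ k → predecessor (insertMax w k) (inject₁ v) ≡ suc n
predecessor-insertMax-after w k w-inj v p≡k =
  trans (cong (before (insertMax w k) ∘ inject₁) (position-insertMax-inject₁ w k w-inj v))
        (before-insertMax-after w k _ p≡k)

predecessor-insertMax-other : (w : Word n) (k : Fin (suc n)) → IsPerm w → ∀ v →
  inject₁ (position w v) ≢ k → predecessor (insertMax w k) (inject₁ v) ≡ predecessor w v
predecessor-insertMax-other w k w-inj v p≢k =
  trans (cong (before (insertMax w k) ∘ inject₁) (position-insertMax-inject₁ w k w-inj v))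
        (before-insertMax-other w k _ p≢k)

before-≤ : (w : Word n) (k : Fin (suc n)) → before w k ≤ n
before-≤ w zero = z≤n
before-≤ w (suc p) rewrite before-suc w p = toℕ<n (lookup w p)

before-inject₁≢letter : (w : Word n) → IsPerm w → ∀ p → before w (inject₁ p) ≢ suc (toℕ (lookup w p))
before-inject₁≢letter w w-inj zero ()
before-inject₁≢letter w w-inj (suc p) eq = 1+n≢n (trans (sym (cong toℕ p≡p+1)) (toℕ-inject₁ p))
  where
  p≡p+1 : inject₁ p ≡ suc p
  p≡p+1 = w-inj (toℕ-injective (suc-injective (trans (sym (before-suc w (inject₁ p))) eq)))

gapAfterMax : Word n → Fin (suc n)
gapAfterMax {zero} w = zero
gapAfterMax {suc n} w = suc (position w (fromℕ n))

before-gapAfterMax : (w : Word n) → IsPerm w → before w (gapAfterMax w) ≡ n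
before-gapAfterMax {zero} w w-inj = refl
before-gapAfterMax {suc n} w w-inj = begin
  before w (suc (position w (fromℕ n)))      ≡⟨ before-suc w _ ⟩
  suc (toℕ (lookup w (position w (fromℕ n)))) ≡⟨ cong (suc ∘ toℕ) (lookup-position w w-inj (fromℕ n)) ⟩
  suc (toℕ (fromℕ n))                        ≡⟨ cong suc (toℕ-fromℕ n) ⟩
  suc n                                      ∎
  where open ≡-Reasoning

before≡⇒gapAfterMax : (w : Word n) → IsPerm w → ∀ k → before w k ≡ n → k ≡ gapAfterMax w
before≡⇒gapAfterMax {zero} w w-inj zero _ = refl
before≡⇒gapAfterMax {suc n} w w-inj (suc p) eq = cong suc (sym (lookup⇒position w w-inj wₚ≡max))
  where
  wₚ≡max : lookup w p ≡ fromℕ n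
  wₚ≡max = toℕ-injective (trans (suc-injective (trans (sym (before-suc w p)) eq)) (sym (toℕ-fromℕ n)))

-- Gap k receives the letter following it, except that the gap after the largest letter
-- and the last gap exchange roles; the letter "following" the last gap is the new maximum.
swapGaps : Word n → Fin (suc n) → Fin (suc n)
swapGaps {n} w = transpose (gapAfterMax w) (fromℕ n)

gapValue : Word n → Fin (suc n) → Fin (suc n)
gapValue w k = lookup (appendMax w) (swapGaps w k)

valueGap : Word n → Fin (suc n) → Fin (suc n)
valueGap {n} w b = transpose (fromℕ n) (gapAfterMax w) (position (appendMax w) b)

valueGap-gapValue : (w : Word n) → IsPerm w → ∀ k → valueGap w (gapValue w k) ≡ k
valueGap-gapValue {n} w w-inj k = begin
  transpose (fromℕ n) (gapAfterMax w) (position (appendMax w) (lookup (appendMax w) (swapGaps w k)))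
    ≡⟨ cong (transpose (fromℕ n) (gapAfterMax w)) (position-lookup (appendMax w) (appendMax-isPerm w w-inj) (swapGaps w k)) ⟩
  transpose (fromℕ n) (gapAfterMax w) (transpose (gapAfterMax w) (fromℕ n) k)
    ≡⟨ transpose-inverse (fromℕ n) (gapAfterMax w) {k} ⟩
  k ∎
  where open ≡-Reasoning

gapValue-valueGap : (w : Word n) → IsPerm w → ∀ b → gapValue w (valueGap w b) ≡ b
gapValue-valueGap {n} w w-inj b = begin
  lookup (appendMax w) (transpose (gapAfterMax w) (fromℕ n) (transpose (fromℕ n) (gapAfterMax w) (position (appendMax w) b)))
    ≡⟨ cong (lookup (appendMax w)) (transpose-inverse (gapAfterMax w) (fromℕ n) {position (appendMax w) b}) ⟩
  lookup (appendMax w) (position (appendMax w) b)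
    ≡⟨ lookup-position (appendMax w) (appendMax-isPerm w w-inj) b ⟩
  b ∎
  where open ≡-Reasoning

gapValue-gapAfterMax : (w : Word n) → gapValue w (gapAfterMax w) ≡ fromℕ n
gapValue-gapAfterMax {n} w =
  trans (cong (lookup (appendMax w)) (transpose-left (gapAfterMax w) (fromℕ n))) (lookup-insertMax-self w (fromℕ n))

gapValue-letter : (w : Word n) → IsPerm w → ∀ k → k ≢ gapAfterMax w →
  ∃ λ c → gapValue w k ≡ inject₁ c × inject₁ (position w c) ≡ swapGaps w k
gapValue-letter {n} w w-inj k k≢m with fromℕ-or-inject₁ (swapGaps w k)
... | inj₁ tₖ≡last = contradiction k≡m k≢m
  where
  k≡m : k ≡ gapAfterMax w
  k≡m = begin
    k                                                             ≡⟨ transpose-inverse (fromℕ n) (gapAfterMax w) ⟨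
    transpose (fromℕ n) (gapAfterMax w) (swapGaps w k)            ≡⟨ cong (transpose (fromℕ n) (gapAfterMax w)) tₖ≡last ⟩
    transpose (fromℕ n) (gapAfterMax w) (fromℕ n)                 ≡⟨ transpose-left (fromℕ n) (gapAfterMax w) ⟩
    gapAfterMax w                                                 ∎
    where open ≡-Reasoning
... | inj₂ (p , tₖ≡p) = lookup w p , trans (cong (lookup (appendMax w)) tₖ≡p) (lookup-appendMax-inject₁ w p) ,
                        trans (cong inject₁ (position-lookup w w-inj p)) (sym tₖ≡p)

gapValue-followingLetter : (w : Word n) → IsPerm w → ∀ k v → k ≢ gapAfterMax w →
  inject₁ (position w v) ≡ k → gapValue w k ≡ inject₁ v
gapValue-followingLetter {n} w w-inj k v k≢m refl with gapValue-letter w w-inj k k≢m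
... | c , g≡c , pc≡t = trans g≡c (cong inject₁ c≡v)
  where
  pc≡pv : inject₁ (position w c) ≡ inject₁ (position w v)
  pc≡pv = trans pc≡t (transpose-other (gapAfterMax w) (fromℕ n) k k≢m (fromℕ≢inject₁ ∘ sym))
  c≡v : c ≡ v
  c≡v = trans (sym (lookup-position w w-inj c))
              (trans (cong (lookup w) (inject₁-injective pc≡pv)) (lookup-position w w-inj v))

gapValue-inject₁⇒≢gapAfterMax : (w : Word n) (k : Fin (suc n)) (c : Fin n) →
  gapValue w k ≡ inject₁ c → k ≢ gapAfterMax w
gapValue-inject₁⇒≢gapAfterMax w k c g≡c refl = fromℕ≢inject₁ (trans (sym (gapValue-gapAfterMax w)) g≡c)

gapValue-inject₁-follows : (w : Word n) → IsPerm w → ∀ k c → gapValue w k ≡ inject₁ c →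
  inject₁ (position w c) ≡ k ⊎ predecessor w c ≡ n
gapValue-inject₁-follows {n} w w-inj k c g≡c
  with k≢m ← gapValue-inject₁⇒≢gapAfterMax w k c g≡c
  with c′ , g≡c′ , pc′≡t ← gapValue-letter w w-inj k k≢m
  with refl ← inject₁-injective (trans (sym g≡c′) g≡c)
  with k ≟ fromℕ n
... | no k≢last = inj₁ (trans pc′≡t (transpose-other (gapAfterMax w) (fromℕ n) k k≢m k≢last))
... | yes refl = inj₂ (begin
  before w (inject₁ (position w c))  ≡⟨ cong (before w) pc′≡t ⟩
  before w (swapGaps w (fromℕ n))    ≡⟨ cong (before w) (transpose-right (gapAfterMax w) (fromℕ n)) ⟩
  before w (gapAfterMax w)           ≡⟨ before-gapAfterMax w w-inj ⟩
  n                                  ∎)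
  where open ≡-Reasoning

-- The bijection

Φ : Word n → Word n
Φ {zero} w = w
Φ {suc n} w = extend (Φ (removeTop w)) (gapValue (removeTop w) (maxPosition w))

Φ⁻¹ : Word n → Word n
Φ⁻¹ {zero} τ = τ
Φ⁻¹ {suc n} τ = insertMax (Φ⁻¹ (retract τ)) (valueGap (Φ⁻¹ (retract τ)) (lookup τ (fromℕ n)))

Φ-isPerm : (w : Word n) → IsPerm w → IsPerm (Φ w)
Φ-isPerm {zero} w w-inj = w-inj
Φ-isPerm {suc n} w w-inj = extend-isPerm (Φ (removeTop w)) _ (Φ-isPerm (removeTop w) (removeTop-isPerm w w-inj))

Φ⁻¹-isPerm : (τ : Word n) → IsPerm τ → IsPerm (Φ⁻¹ τ)
Φ⁻¹-isPerm {zero} τ τ-inj = τ-inj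
Φ⁻¹-isPerm {suc n} τ τ-inj = insertMax-isPerm σ' (valueGap σ' (lookup τ (fromℕ n))) σ'-inj
  where
  σ' = Φ⁻¹ (retract τ)
  σ'-inj = Φ⁻¹-isPerm (retract τ) (retract-isPerm τ τ-inj)

Φ⁻¹-Φ : (w : Word n) → IsPerm w → Φ⁻¹ (Φ w) ≡ w
Φ⁻¹-Φ {zero} w w-inj = refl
Φ⁻¹-Φ {suc n} w w-inj = begin
  insertMax (Φ⁻¹ (retract (extend τ' b))) (valueGap (Φ⁻¹ (retract (extend τ' b))) (lookup (extend τ' b) (fromℕ n)))
    ≡⟨ cong₂ (λ τ c → insertMax (Φ⁻¹ τ) (valueGap (Φ⁻¹ τ) c)) (retract-extend τ' b) (lookup-extend-last τ' b) ⟩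
  insertMax (Φ⁻¹ τ') (valueGap (Φ⁻¹ τ') b)
    ≡⟨ cong (λ σ → insertMax σ (valueGap σ b)) (Φ⁻¹-Φ σ' σ'-inj) ⟩
  insertMax σ' (valueGap σ' (gapValue σ' k))
    ≡⟨ cong (insertMax σ') (valueGap-gapValue σ' σ'-inj k) ⟩
  insertMax σ' k
    ≡⟨ insertMax-removeTop w w-inj ⟩
  w ∎
  where
  open ≡-Reasoning
  k = maxPosition w
  σ' = removeTop w
  σ'-inj = removeTop-isPerm w w-inj
  τ' = Φ σ'
  b = gapValue σ' k

Φ-Φ⁻¹ : (τ : Word n) → IsPerm τ → Φ (Φ⁻¹ τ) ≡ τ
Φ-Φ⁻¹ {zero} τ τ-inj = refl
Φ-Φ⁻¹ {suc n} τ τ-inj = begin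
  extend (Φ (removeMax σ k′)) (gapValue (removeMax σ k′) k′)
    ≡⟨ cong (λ x → extend (Φ (removeMax σ x)) (gapValue (removeMax σ x) x)) (maxPosition-insertMax σ' k σ'-inj) ⟩
  extend (Φ (removeMax σ k)) (gapValue (removeMax σ k) k)
    ≡⟨ cong (λ x → extend (Φ x) (gapValue x k)) (removeMax-insertMax σ' k) ⟩
  extend (Φ σ') (gapValue σ' k)
    ≡⟨ cong₂ extend (Φ-Φ⁻¹ (retract τ) (retract-isPerm τ τ-inj)) (gapValue-valueGap σ' σ'-inj b) ⟩
  extend (retract τ) b
    ≡⟨ extend-retract τ τ-inj ⟩
  τ ∎
  where
  open ≡-Reasoning
  σ' = Φ⁻¹ (retract τ)
  σ'-inj = Φ⁻¹-isPerm (retract τ) (retract-isPerm τ τ-inj)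
  b = lookup τ (fromℕ n)
  k = valueGap σ' b
  σ = insertMax σ' k
  k′ = maxPosition σ

-- Letter orders and position orders

data Order : Set where
  less equal greater : Order

order : ℕ → ℕ → Order
order zero zero = equal
order zero (suc n) = less
order (suc m) zero = greater
order (suc m) (suc n) = order m n

order-equal : ∀ n → order n n ≡ equal
order-equal zero = refl
order-equal (suc n) = order-equal n

order-less : m < n → order m n ≡ less
order-less {zero} (s≤s _) = refl
order-less {suc m} (s≤s m<n) = order-less m<n

order-greater : n < m → order m n ≡ greater
order-greater {zero} (s≤s _) = refl
order-greater {suc n} (s≤s n<m) = order-greater n<m

-- predecessor counts values from 1 and toℕ v from 0, so `equal` means that v directly
-- follows the value v - 1.
letterOrder : Word n → Fin n → Order
letterOrder σ v = order (predecessor σ v) (toℕ v)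

positionOrder : Word n → Fin n → Order
positionOrder τ v = order (toℕ (position τ v)) (toℕ v)

Matches : Word n → Word n → Set
Matches σ τ = ∀ v → letterOrder σ v ≡ positionOrder τ v

module _ {n} (σ' τ' : Word n) (σ'-inj : IsPerm σ') (τ'-inj : IsPerm τ') (k : Fin (suc n)) where

  private
    σ = insertMax σ' k
    b = gapValue σ' k
    τ = extend τ' b

  letterOrder-max : letterOrder σ (fromℕ n) ≡ order (before σ' k) n
  letterOrder-max = cong₂ order (predecessor-insertMax-max σ' k σ'-inj) (toℕ-fromℕ n)

  letterOrder-afterMax : ∀ v → inject₁ (position σ' v) ≡ k → letterOrder σ (inject₁ v) ≡ greater
  letterOrder-afterMax v p≡k = trans (cong₂ order (predecessor-insertMax-after σ' k σ'-inj v p≡k) (toℕ-inject₁ v))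
                                  (order-greater (m<n⇒m<1+n (toℕ<n v)))

  letterOrder-notAfterMax : ∀ v → inject₁ (position σ' v) ≢ k → letterOrder σ (inject₁ v) ≡ letterOrder σ' v
  letterOrder-notAfterMax v p≢k = cong₂ order (predecessor-insertMax-other σ' k σ'-inj v p≢k) (toℕ-inject₁ v)

  positionOrder-lastValue : ∀ v → inject₁ v ≡ b → positionOrder τ (inject₁ v) ≡ greater
  positionOrder-lastValue v v≡b = begin
    order (toℕ (position τ (inject₁ v))) (toℕ (inject₁ v)) ≡⟨ cong₂ order (cong toℕ pτv≡last) (toℕ-inject₁ v) ⟩
    order (toℕ (fromℕ n)) (toℕ v)                         ≡⟨ cong (λ x → order x (toℕ v)) (toℕ-fromℕ n) ⟩
    order n (toℕ v)                                       ≡⟨ order-greater (toℕ<n v) ⟩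
    greater                                               ∎
    where
    open ≡-Reasoning
    pτv≡last : position τ (inject₁ v) ≡ fromℕ n
    pτv≡last = trans (cong (position τ) v≡b) (position-extend-last τ' b τ'-inj)

  positionOrder-notLastValue : ∀ v → inject₁ v ≢ b → positionOrder τ (inject₁ v) ≡ positionOrder τ' v
  positionOrder-notLastValue v v≢b = cong₂ order
    (trans (cong toℕ (position-extend-inject₁ τ' b τ'-inj v v≢b)) (toℕ-inject₁ _)) (toℕ-inject₁ v)

  matches-max : Dec (k ≡ gapAfterMax σ') → letterOrder σ (fromℕ n) ≡ positionOrder τ (fromℕ n)
  matches-max (yes refl) = begin
    letterOrder σ (fromℕ n)                         ≡⟨ letterOrder-max ⟩
    order (before σ' (gapAfterMax σ')) n            ≡⟨ cong (λ x → order x n) (before-gapAfterMax σ' σ'-inj) ⟩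
    order n n                                       ≡⟨ order-equal n ⟩
    equal                                           ≡⟨ order-equal (toℕ (fromℕ n)) ⟨
    order (toℕ (fromℕ n)) (toℕ (fromℕ n))            ≡⟨ cong (λ x → order (toℕ x) (toℕ (fromℕ n))) pτmax≡last ⟨
    positionOrder τ (fromℕ n)                       ∎
    where
    open ≡-Reasoning
    pτmax≡last : position τ (fromℕ n) ≡ fromℕ n
    pτmax≡last = trans (cong (position τ) (sym (gapValue-gapAfterMax σ'))) (position-extend-last τ' b τ'-inj)
  matches-max (no k≢m) with c , b≡c , _ ← gapValue-letter σ' σ'-inj k k≢m = begin
    letterOrder σ (fromℕ n)                              ≡⟨ letterOrder-max ⟩
    order (before σ' k) n                                ≡⟨ order-less before<n ⟩
    less                                                 ≡⟨ order-less (toℕ<n (position τ' c)) ⟨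
    order (toℕ (position τ' c)) n                        ≡⟨ cong₂ order (toℕ-inject₁ (position τ' c)) (toℕ-fromℕ n) ⟨
    order (toℕ (inject₁ (position τ' c))) (toℕ (fromℕ n)) ≡⟨ cong (λ x → order (toℕ x) (toℕ (fromℕ n))) pτmax≡c ⟨
    positionOrder τ (fromℕ n)                            ∎
    where
    open ≡-Reasoning
    before<n : before σ' k < n
    before<n = ≤∧≢⇒< (before-≤ σ' k) (k≢m ∘ before≡⇒gapAfterMax σ' σ'-inj k)
    pτmax≡c : position τ (fromℕ n) ≡ inject₁ (position τ' c)
    pτmax≡c = trans (cong (λ x → position (extend τ' x) (fromℕ n)) b≡c) (position-extend-max τ' c τ'-inj)

  letterOrder-greater-preserved : ∀ v → letterOrder σ' v ≡ greater → letterOrder σ (inject₁ v) ≡ greater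
  letterOrder-greater-preserved v greater′ = by (inject₁ (position σ' v) ≟ k)
    where
    by : Dec (inject₁ (position σ' v) ≡ k) → letterOrder σ (inject₁ v) ≡ greater
    by (yes p≡k) = letterOrder-afterMax v p≡k
    by (no p≢k) = trans (letterOrder-notAfterMax v p≢k) greater′

  letterOrder-lastValue : ∀ v → inject₁ v ≡ b → letterOrder σ (inject₁ v) ≡ greater
  letterOrder-lastValue v v≡b with gapValue-inject₁-follows σ' σ'-inj k v (sym v≡b)
  ... | inj₁ p≡k = letterOrder-afterMax v p≡k
  ... | inj₂ pred≡n = letterOrder-greater-preserved v (trans (cong (λ x → order x (toℕ v)) pred≡n) (order-greater (toℕ<n v)))

  -- A letter right after the inserted maximum is b unless k is the gap after the old
  -- maximum, and then it already followed the old maximum in σ'.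
  letterOrder-notLastValue : ∀ v → inject₁ v ≢ b → letterOrder σ (inject₁ v) ≡ letterOrder σ' v
  letterOrder-notLastValue v v≢b = by (inject₁ (position σ' v) ≟ k)
    where
    greater′ : inject₁ (position σ' v) ≡ k → Dec (k ≡ gapAfterMax σ') → letterOrder σ' v ≡ greater
    greater′ p≡k (yes k≡m) = begin
      order (before σ' (inject₁ (position σ' v))) (toℕ v) ≡⟨ cong (λ x → order (before σ' x) (toℕ v)) (trans p≡k k≡m) ⟩
      order (before σ' (gapAfterMax σ')) (toℕ v)         ≡⟨ cong (λ x → order x (toℕ v)) (before-gapAfterMax σ' σ'-inj) ⟩
      order n (toℕ v)                                    ≡⟨ order-greater (toℕ<n v) ⟩
      greater                                            ∎
      where open ≡-Reasoning
    greater′ p≡k (no k≢m) = contradiction (sym (gapValue-followingLetter σ' σ'-inj k v k≢m p≡k)) v≢b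
    by : Dec (inject₁ (position σ' v) ≡ k) → letterOrder σ (inject₁ v) ≡ letterOrder σ' v
    by (yes p≡k) = trans (letterOrder-afterMax v p≡k) (sym (greater′ p≡k (k ≟ gapAfterMax σ')))
    by (no p≢k) = letterOrder-notAfterMax v p≢k

  matches-inject₁ : Matches σ' τ' → ∀ v → Dec (inject₁ v ≡ b) →
    letterOrder σ (inject₁ v) ≡ positionOrder τ (inject₁ v)
  matches-inject₁ _ v (yes v≡b) = trans (letterOrder-lastValue v v≡b) (sym (positionOrder-lastValue v v≡b))
  matches-inject₁ match v (no v≢b) = begin
    letterOrder σ (inject₁ v)   ≡⟨ letterOrder-notLastValue v v≢b ⟩
    letterOrder σ' v            ≡⟨ match v ⟩
    positionOrder τ' v          ≡⟨ positionOrder-notLastValue v v≢b ⟨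
    positionOrder τ (inject₁ v) ∎
    where open ≡-Reasoning

  matches-insertMax-extend : Matches σ' τ' → Matches σ τ
  matches-insertMax-extend match v with fromℕ-or-inject₁ v
  ... | inj₁ refl = matches-max (k ≟ gapAfterMax σ')
  ... | inj₂ (v′ , refl) = matches-inject₁ match v′ (inject₁ v′ ≟ b)

matches-Φ : (w : Word n) → IsPerm w → Matches w (Φ w)
matches-Φ {zero} w w-inj ()
matches-Φ {suc n} w w-inj = subst (λ σ → Matches σ (Φ w)) (insertMax-removeTop w w-inj)
  (matches-insertMax-extend σ' (Φ σ') σ'-inj (Φ-isPerm σ' σ'-inj) (maxPosition w) (matches-Φ σ' σ'-inj))
  where
  σ' = removeTop w
  σ'-inj = removeTop-isPerm w w-inj

-- The statistics through orders

isLess isEqual isGreater : Order → Bool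
isLess less = true
isLess _ = false
isEqual equal = true
isEqual _ = false
isGreater greater = true
isGreater _ = false

<ᵇ-isLess : ∀ m n → (m <ᵇ n) ≡ isLess (order m n)
<ᵇ-isLess zero zero = refl
<ᵇ-isLess zero (suc n) = refl
<ᵇ-isLess (suc m) zero = refl
<ᵇ-isLess (suc m) (suc n) = <ᵇ-isLess m n

≡ᵇ-isEqual : ∀ m n → (m ≡ᵇ n) ≡ isEqual (order m n)
≡ᵇ-isEqual zero zero = refl
≡ᵇ-isEqual zero (suc n) = refl
≡ᵇ-isEqual (suc m) zero = refl
≡ᵇ-isEqual (suc m) (suc n) = ≡ᵇ-isEqual m n

>ᵇ-isGreater : ∀ m n → (n <ᵇ m) ≡ isGreater (order m n)
>ᵇ-isGreater zero zero = refl
>ᵇ-isGreater zero (suc n) = refl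
>ᵇ-isGreater (suc m) zero = refl
>ᵇ-isGreater (suc m) (suc n) = >ᵇ-isGreater m n

suc<ᵇ : ∀ m n → m ≢ suc n → (suc n <ᵇ m) ≡ (n <ᵇ m)
suc<ᵇ zero n _ = refl
suc<ᵇ (suc zero) zero m≢1 = contradiction refl m≢1
suc<ᵇ (suc (suc m)) zero _ = refl
suc<ᵇ (suc m) (suc n) m≢n+2 = suc<ᵇ m n (m≢n+2 ∘ cong suc)

des≡count : (σ : Perm n) → des σ ≡ count (λ i → val σ i <ᵇ prevVal σ i)
des≡count {zero} σ = refl
des≡count {suc n} σ = trans (count-tabulate (λ i → val σ (suc i) <ᵇ val σ (inject₁ i)) id)
                             (sym (count-tabulate (λ i → val σ i <ᵇ prevVal σ i) id))

any-tabulate-false : ∀ {A : Set} (f : A → Bool) (h : Fin n → A) → (∀ i → f (h i) ≡ false) → any f (tabulateL h) ≡ false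
any-tabulate-false {zero} f h _ = refl
any-tabulate-false {suc n} f h all-false rewrite all-false zero = any-tabulate-false f (h ∘ suc) (all-false ∘ suc)

any-tabulate-single : ∀ {A : Set} (f : A → Bool) (h : Fin n → A) j → (∀ i → i ≢ j → f (h i) ≡ false) →
  any f (tabulateL h) ≡ f (h j)
any-tabulate-single {suc n} f h zero others rewrite any-tabulate-false f (h ∘ suc) (λ i → others (suc i) λ ()) =
  ∨-identityʳ (f (h zero))
any-tabulate-single {suc n} f h (suc j) others rewrite others zero (λ ()) =
  any-tabulate-single f (h ∘ suc) j (λ i i≢j → others (suc i) (i≢j ∘ Fin-suc-injective))

module _ {n} (σ : Perm n) where

  private
    w = word σ
    w-inj = proj₂ σ

  prevVal-position : ∀ v → prevVal σ (position w v) ≡ predecessor w v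
  prevVal-position v with position w v
  ... | zero = refl
  ... | suc i = sym (before-suc w (inject₁ i))

  val-position : ∀ v → val σ (position w v) ≡ suc (toℕ v)
  val-position v = cong (suc ∘ toℕ) (lookup-position w w-inj v)

  jump≡count-less : jump σ ≡ count (isLess ∘ letterOrder w)
  jump≡count-less = trans (count-byValue w w-inj _) (count-cong λ v →
    trans (cong₂ (λ p q → suc p <ᵇ q) (prevVal-position v) (val-position v)) (<ᵇ-isLess (predecessor w v) (toℕ v)))

  des≡count-greater : des σ ≡ count (isGreater ∘ letterOrder w)
  des≡count-greater = trans (des≡count σ) (trans (count-byValue w w-inj _) (count-cong λ v → begin
    val σ (position w v) <ᵇ prevVal σ (position w v) ≡⟨ cong₂ _<ᵇ_ (val-position v) (prevVal-position v) ⟩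
    suc (toℕ v) <ᵇ predecessor w v                   ≡⟨ suc<ᵇ (predecessor w v) (toℕ v) (predecessor≢self v) ⟩
    toℕ v <ᵇ predecessor w v                         ≡⟨ >ᵇ-isGreater (predecessor w v) (toℕ v) ⟩
    isGreater (letterOrder w v)                      ∎))
    where
    open ≡-Reasoning
    predecessor≢self : ∀ v → predecessor w v ≢ suc (toℕ v)
    predecessor≢self v eq = before-inject₁≢letter w w-inj (position w v)
      (trans eq (cong (suc ∘ toℕ) (sym (lookup-position w w-inj v))))

  Lbar≡equal : Lbar σ ≡ tabulate (isEqual ∘ letterOrder w)
  Lbar≡equal = tabulate-cong λ v → begin
    any (succession v) (allFinL n)
      ≡⟨ any-tabulate-single (succession v) id (position w v) (notThere v) ⟩
    succession v (position w v)
      ≡⟨ cong₂ (λ p q → (q ≡ᵇ suc (toℕ v)) ∧ (suc p ≡ᵇ q)) (prevVal-position v) (val-position v) ⟩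
    (toℕ v ≡ᵇ toℕ v) ∧ (predecessor w v ≡ᵇ toℕ v)
      ≡⟨ cong (_∧ (predecessor w v ≡ᵇ toℕ v)) (dec-true (toℕ v ≟ℕ toℕ v) refl) ⟩
    predecessor w v ≡ᵇ toℕ v
      ≡⟨ ≡ᵇ-isEqual (predecessor w v) (toℕ v) ⟩
    isEqual (letterOrder w v) ∎
    where
    open ≡-Reasoning
    succession : Fin n → Fin n → Bool
    succession v i = (val σ i ≡ᵇ suc (toℕ v)) ∧ (suc (prevVal σ i) ≡ᵇ val σ i)
    notThere : ∀ v i → i ≢ position w v → succession v i ≡ false
    notThere v i i≢p
      rewrite dec-false (toℕ (lookup w i) ≟ℕ toℕ v) (i≢p ∘ sym ∘ lookup⇒position w w-inj ∘ toℕ-injective) = refl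

module _ {n} (τ : Perm n) where

  private
    t = word τ
    t-inj = proj₂ τ

  exc≡count-less : exc τ ≡ count (isLess ∘ positionOrder t)
  exc≡count-less = trans (count-byValue t t-inj _) (count-cong λ v →
    trans (cong (suc (toℕ (position t v)) <ᵇ_) (val-position τ v)) (<ᵇ-isLess (toℕ (position t v)) (toℕ v)))

  drop≡count-greater : drop τ ≡ count (isGreater ∘ positionOrder t)
  drop≡count-greater = trans (count-byValue t t-inj _) (count-cong λ v →
    trans (cong (_<ᵇ suc (toℕ (position t v))) (val-position τ v)) (>ᵇ-isGreater (toℕ (position t v)) (toℕ v)))

  Fix≡equal : Fix τ ≡ tabulate (isEqual ∘ positionOrder t)
  Fix≡equal = tabulate-cong λ v →
    trans (does-⇔ (mk⇔ fixed⇒ ⇒fixed) (toℕ (lookup t v) ≟ℕ toℕ v) (toℕ (position t v) ≟ℕ toℕ v))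
          (≡ᵇ-isEqual (toℕ (position t v)) (toℕ v))
    where
    fixed⇒ : ∀ {v} → toℕ (lookup t v) ≡ toℕ v → toℕ (position t v) ≡ toℕ v
    fixed⇒ eq = cong toℕ (lookup⇒position t t-inj (toℕ-injective eq))
    ⇒fixed : ∀ {v} → toℕ (position t v) ≡ toℕ v → toℕ (lookup t v) ≡ toℕ v
    ⇒fixed {v} eq = cong toℕ (trans (cong (lookup t) (sym (toℕ-injective eq))) (lookup-position t t-inj v))

module _ {n} (σ τ : Perm n) (match : Matches (word σ) (word τ)) where

  jump≡exc : jump σ ≡ exc τ
  jump≡exc = trans (jump≡count-less σ) (trans (count-cong (cong isLess ∘ match)) (sym (exc≡count-less τ)))

  des≡drop : des σ ≡ drop τ
  des≡drop = trans (des≡count-greater σ) (trans (count-cong (cong isGreater ∘ match)) (sym (drop≡count-greater τ)))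

  Lbar≡Fix : Lbar σ ≡ Fix τ
  Lbar≡Fix = trans (Lbar≡equal σ) (trans (tabulate-cong (cong isEqual ∘ match)) (sym (Fix≡equal τ)))

Φₚ : Perm n → Perm n
Φₚ (w , w-inj) = Φ w , Φ-isPerm w w-inj

Φ⁻¹ₚ : Perm n → Perm n
Φ⁻¹ₚ (τ , τ-inj) = Φ⁻¹ τ , Φ⁻¹-isPerm τ τ-inj

matches-Φₚ : (σ : Perm n) → Matches (word σ) (word (Φₚ σ))
matches-Φₚ (w , w-inj) = matches-Φ w w-inj

Fix-cong : (σ τ : Perm n) → word σ ≡ word τ → Fix σ ≡ Fix τ
Fix-cong (w , _) (.w , _) refl = refl

theorem4p3 : (n : ℕ) → n ≥ 1 → (I : Subset n) →
    Σ ((σ : Perm n) → Lbar σ ≡ I → Σ (Perm n) (λ τ → Fix τ ≡ I)) λ Φ →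
    Σ ((τ : Perm n) → Fix τ ≡ I → Σ (Perm n) (λ σ → Lbar σ ≡ I)) λ Ψ →
      ((σ : Perm n) (p : Lbar σ ≡ I) →
          word (proj₁ (Ψ (proj₁ (Φ σ p)) (proj₂ (Φ σ p)))) ≡ word σ)
      × ((τ : Perm n) (q : Fix τ ≡ I) →
          word (proj₁ (Φ (proj₁ (Ψ τ q)) (proj₂ (Ψ τ q)))) ≡ word τ)
      × ((σ : Perm n) (p : Lbar σ ≡ I) →
          (jump σ ≡ exc (proj₁ (Φ σ p))) × (des σ ≡ drop (proj₁ (Φ σ p))))
theorem4p3 n _ I =
  toFixed , toSuccessions ,
  (λ σ _ → Φ⁻¹-Φ (word σ) (proj₂ σ)) ,
  (λ τ _ → Φ-Φ⁻¹ (word τ) (proj₂ τ)) ,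
  (λ σ _ → jump≡exc σ (Φₚ σ) (matches-Φₚ σ) , des≡drop σ (Φₚ σ) (matches-Φₚ σ))
  where
  toFixed : (σ : Perm n) → Lbar σ ≡ I → Σ (Perm n) (λ τ → Fix τ ≡ I)
  toFixed σ Lσ≡I = Φₚ σ , trans (sym (Lbar≡Fix σ (Φₚ σ) (matches-Φₚ σ))) Lσ≡I
  toSuccessions : (τ : Perm n) → Fix τ ≡ I → Σ (Perm n) (λ σ → Lbar σ ≡ I)
  toSuccessions τ Fτ≡I = σ , (begin
    Lbar σ       ≡⟨ Lbar≡Fix σ (Φₚ σ) (matches-Φₚ σ) ⟩
    Fix (Φₚ σ)   ≡⟨ Fix-cong (Φₚ σ) τ (Φ-Φ⁻¹ (word τ) (proj₂ τ)) ⟩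
    Fix τ        ≡⟨ Fτ≡I ⟩
    I            ∎)
    where
    open ≡-Reasoning
    σ = Φ⁻¹ₚ τ
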